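{- Let $D$ be a non-zero square-free integer and $m$, $n$ be non-zero integers. Each solution to the congruence equations \begin {align*} x^2 &\equiv D \ ( \mathrm{mod} \ 4m) \ \text{for} \ 0\leq x \leq 2 |m| -1, \\ y^2 &\equiv D \ ( \mathrm{mod} \ 4n ) \ \text{for} \ 0\leq y \leq 2 |n| -1, \end{align*} determines a unique orbit of integer cubes in $\left(B'_{2}(\mathbb{Z}) \times B'_{2}(\mathbb{Z}) \times \mathrm{SL}_{2}(\mathbb{Z}) \right) \backslash V^{ss}_{\mathbb{Z}}$ such that \begin{align*} \mathrm{disc}(A) &= D , \\ Q_1(A)(u,v) &= mu^2+ x uv+ s v^2, \\ Q_2(A)(u,v) &=nu^2 + yuv + t v^2 \end{align*} for some integers $s,t$. Moreover, two different solutions to the congruence equations correspond to two different orbits of integer cubes in $\left( B'_{2}(\mathbb{Z}) \times B'_{2}(\mathbb{Z}) \times \mathrm{SL}_{2}(\mathbb{Z}) \right) \backslash V^{ss}_{\mathbb{Z}}$.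
   Context: A $2\times2\times2$ integer cube is $A = \left( \left( \begin{smallmatrix} a & b \\ c & d \end{smallmatrix} \right), \left( \begin{smallmatrix} e & f \\ g & h \end{smallmatrix} \right) \right)$, with $Q_1(A)(u,v)=u^2(ad-bc)+uv(-ah+bg+cf-de)+v^2(eh-fg)$, $Q_2(A)(u,v)=u^2(ag-ce)+uv(-ah-bg+cf+de)+v^2(bh-df)$ and $\mathrm{disc}(A)=(-ah+bg+cf-de)^2-4(ad-bc)(eh-fg)$. The group $B'_2(\mathbb{Z}) \times B'_2(\mathbb{Z}) \times \mathrm{SL}_2(\mathbb{Z})$ ($B'_2(\mathbb{Z})$: lower-triangular matrices in $\mathrm{SL}_2(\mathbb{Z})$ with positive diagonal) acts with the $i$-th factor acting on the pair $(M_i,N_i)$ of opposite faces, $(M_1,N_1)=(\left(\begin{smallmatrix} a&b\\ c&d\end{smallmatrix}\right),\left(\begin{smallmatrix} e&f\\ g&h\end{smallmatrix}\right))$, $(M_2,N_2)=(\left(\begin{smallmatrix} a&c\\ e&g\end{smallmatrix}\right),\left(\begin{smallmatrix} b&d\\ f&h\end{smallmatrix}\right))$, $(M_3,N_3)=(\left(\begin{smallmatrix} a&e\\ b&f\end{smallmatrix}\right),\left(\begin{smallmatrix} c&g\\ d&h\end{smallmatrix}\right))$, where $\left(\begin{smallmatrix} g_{11}&g_{12}\\ g_{21}&g_{22}\end{smallmatrix}\right)$ sends $(M,N)$ to $(g_{11}M+g_{12}N, g_{21}M+g_{22}N)$. $V^{ss}_{\mathbb{Z}}$ is the set of cubes with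 $ad-bc$, $ag-ce$, $\mathrm{disc}(A)$ all nonzero. -}

module Defs where

open import Data.Integer using (ℤ; +_; -_; _+_; _*_; _-_; ∣_∣; _≤_; _<_; _>_)
open import Data.Integer.Divisibility using (_∣_)
open import Data.Nat using (ℕ)
open import Data.Product using (Σ; _×_; ∃)
open import Relation.Binary.PropositionalEquality using (_≡_; _≢_)

-- A 2×2×2 integer cube ((a b ; c d) , (e f ; g h)).
record Cube : Set where
  constructor cube
  field
    a b c d e f g h : ℤ

record Mat2 : Set where
  constructor mat
  field
    g₁₁ g₁₂ g₂₁ g₂₂ : ℤ

det : Mat2 → ℤ
det (mat p q r s) = p * s - q * r

InSL2 : Mat2 → Set
InSL2 M = det M ≡ + 1

InB'2 : Mat2 → Set
InB'2 M = InSL2 M × Mat2.g₁₂ M ≡ + 0 × Mat2.g₁₁ M > + 0 × Mat2.g₂₂ M > + 0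

-- Action on the face pair (M₁,N₁) = ((a b;c d),(e f;g h)).
act₁ : Mat2 → Cube → Cube
act₁ (mat p q r s) (cube a b c d e f g h) =
  cube (p * a + q * e) (p * b + q * f) (p * c + q * g) (p * d + q * h)
       (r * a + s * e) (r * b + s * f) (r * c + s * g) (r * d + s * h)

-- Action on the face pair (M₂,N₂) = ((a c;e g),(b d;f h)).
act₂ : Mat2 → Cube → Cube
act₂ (mat p q r s) (cube a b c d e f g h) =
  cube (p * a + q * b) (r * a + s * b) (p * c + q * d) (r * c + s * d)
       (p * e + q * f) (r * e + s * f) (p * g + q * h) (r * g + s * h)

-- Action on the face pair (M₃,N₃) = ((a e;b f),(c g;d h)).
act₃ : Mat2 → Cube → Cube
act₃ (mat p q r s) (cube a b c d e f g h) =
  cube (p * a + q * c) (p * b + q * d) (r * a + s * c) (r * b + s * d)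
       (p * e + q * g) (p * f + q * h) (r * e + s * g) (r * f + s * h)

-- Action of (g₁ , g₂ , g₃) ∈ B'₂(ℤ) × B'₂(ℤ) × SL₂(ℤ) (the three factors commute).
act : Mat2 → Mat2 → Mat2 → Cube → Cube
act g₁ g₂ g₃ A = act₁ g₁ (act₂ g₂ (act₃ g₃ A))

SameOrbit : Cube → Cube → Set
SameOrbit A A' = Σ Mat2 λ g₁ → Σ Mat2 λ g₂ → Σ Mat2 λ g₃ →
  InB'2 g₁ × InB'2 g₂ × InSL2 g₃ × act g₁ g₂ g₃ A ≡ A'

Q₁ : Cube → ℤ → ℤ → ℤ
Q₁ (cube a b c d e f g h) u v =
  u * u * (a * d - b * c) + u * v * (- (a * h) + b * g + c * f - d * e) + v * v * (e * h - f * g)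

Q₂ : Cube → ℤ → ℤ → ℤ
Q₂ (cube a b c d e f g h) u v =
  u * u * (a * g - c * e) + u * v * (- (a * h) - b * g + c * f + d * e) + v * v * (b * h - d * f)

disc : Cube → ℤ
disc (cube a b c d e f g h) =
  (- (a * h) + b * g + c * f - d * e) * (- (a * h) + b * g + c * f - d * e)
  - + 4 * (a * d - b * c) * (e * h - f * g)

InVss : Cube → Set
InVss A@(cube a b c d e f g h) =
  (a * d - b * c ≢ + 0) × (a * g - c * e ≢ + 0) × (disc A ≢ + 0)

SquareFree : ℤ → Set
SquareFree D = ∀ (k : ℤ) → (k * k) ∣ D → ∣ k ∣ ≡ 1

Solution : ℤ → ℤ → ℤ → ℤ → ℤ → Set
Solution D m n x y =
  ((+ 4 * m) ∣ (x * x - D)) × (+ 0 ≤ x) × (x ≤ + 2 * + ∣ m ∣ - + 1) ×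
  ((+ 4 * n) ∣ (y * y - D)) × (+ 0 ≤ y) × (y ≤ + 2 * + ∣ n ∣ - + 1)

Corresponds : ℤ → ℤ → ℤ → ℤ → ℤ → Cube → Set
Corresponds D m n x y A =
  InVss A × disc A ≡ D ×
  Σ ℤ (λ s → ∀ u v → Q₁ A u v ≡ m * u * u + x * u * v + s * v * v) ×
  Σ ℤ (λ t → ∀ u v → Q₂ A u v ≡ n * u * u + y * u * v + t * v * v)

{-# OPTIONS --safe #-}
-- The four columns (a,c), (b,d), (e,g), (f,h) of a cube are vectors in ℤ² on
-- which the SL₂(ℤ)-factor acts by matrix multiplication, and the coefficients
-- of Q₁ and Q₂ are combinations of the six wedge products of these columns
-- which, conversely, they determine. Two families of vectors with the same
-- wedge products, if these generate the unit ideal, are related by a matrix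
-- of SL₂(ℤ), built from Cramer's rule. If D = x² − 4ms is square-free then
-- (m, x, s) is primitive, so two cubes attached to the same solution lie in
-- one orbit. Existence is an explicit cube, after writing x = k + l and
-- y = k − l (x² ≡ y² mod 4 forces x ≡ y mod 2). Finally each B'₂(ℤ)-factor
-- acts on its form by a shear (u, v) ↦ (u − r v, v), which moves x by 2rm
-- (resp. y by 2rn); the range conditions then separate the orbits of
-- different solutions.
module Submission where

open import Defs
open import Data.Integer
  using (ℤ; +_; -[1+_]; _+_; _*_; _-_; -_; ∣_∣; _≤_; _⊖_; +≤+; +<+; ≢-nonZero; _%_; _/_)
import Data.Integer.Properties as ℤ
open import Algebra.Bundles using (AbelianGroup)
open import Algebra.Properties.Group (AbelianGroup.group ℤ.+-0-abelianGroup)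
  using () renaming (∙-cancelˡ to +-cancelˡ; ∙-cancelʳ to +-cancelʳ)
open import Data.Integer.DivMod using (n%d<d; a≡a%n+[a/n]*n)
import Data.Integer.Divisibility as Unsigned
open import Data.Integer.Divisibility.Signed
  using (_∣_; divides; ∣ᵤ⇒∣; ∣⇒∣ᵤ; ∣-trans; m∣∣m∣; ∣m∣n⇒∣m-n)
open import Data.Integer.GCD using (gcd; gcd[i,j]∣i; gcd[i,j]∣j)
open import Data.Integer.Tactic.RingSolver using (solve-∀)
open import Data.Nat as ℕ using (zero; suc)
import Data.Nat.Properties as ℕ
open import Data.Nat.Divisibility using (>⇒∤)
open import Data.Nat.GCD using (gcd-GCD; module Bézout)
open import Data.List using (List; []; _∷_)
open import Data.Product using (Σ; ∃-syntax; _×_; _,_; proj₁; proj₂)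
open import Data.Sum using (_⊎_; inj₁; inj₂)
open import Function using (_∘_)
open import Relation.Binary.PropositionalEquality
  using (_≡_; _≢_; refl; sym; trans; cong; cong₂; subst; module ≡-Reasoning)
open import Relation.Nullary using (¬_; contradiction)

open ≡-Reasoning

cong-triple : ∀ {a b c a′ b′ c′ : ℤ} → a ≡ a′ → b ≡ b′ → c ≡ c′ → (a , b , c) ≡ (a′ , b′ , c′)
cong-triple p q r = cong₂ _,_ p (cong₂ _,_ q r)

*-cancelˡ-≢0 : ∀ k {i j} → k ≢ + 0 → k * i ≡ k * j → i ≡ j
*-cancelˡ-≢0 k k≢0 = ℤ.*-cancelˡ-≡ k _ _ {{≢-nonZero k≢0}}

∣i∣≡1⇒i*i≡1 : ∀ i → ∣ i ∣ ≡ 1 → i * i ≡ + 1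
∣i∣≡1⇒i*i≡1 (+ _)    refl = refl
∣i∣≡1⇒i*i≡1 -[1+ _ ] refl = refl

parity : ∀ x → ∃[ h ] (x ≡ h + h ⊎ x ≡ h + h + + 1)
parity x = classify (x % + 2) (n%d<d x (+ 2)) (a≡a%n+[a/n]*n x (+ 2))
  where
  even : ∀ h → + 0 + h * + 2 ≡ h + h
  even = solve-∀
  odd : ∀ h → + 1 + h * + 2 ≡ h + h + + 1
  odd = solve-∀
  classify : ∀ ρ → ρ ℕ.< 2 → x ≡ + ρ + (x / + 2) * + 2 → ∃[ h ] (x ≡ h + h ⊎ x ≡ h + h + + 1)
  classify 0 _ x≡ = x / + 2 , inj₁ (trans x≡ (even (x / + 2)))
  classify 1 _ x≡ = x / + 2 , inj₂ (trans x≡ (odd (x / + 2)))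
  classify (suc (suc _)) (ℕ.s≤s (ℕ.s≤s ())) _

4∤1 : ¬ (+ 4 ∣ + 1)
4∤1 4∣1 = >⇒∤ (ℕ.s≤s (ℕ.s≤s ℕ.z≤n)) (∣⇒∣ᵤ 4∣1)

same-parity : ∀ x y → + 4 ∣ x * x - y * y → ∃[ k ] ∃[ l ] x ≡ k + l × y ≡ k - l
same-parity x y 4∣x²-y² = combine (parity x) (parity y)
  where
  4∣-subst : ∀ {x′ y′} → x ≡ x′ → y ≡ y′ → + 4 ∣ x′ * x′ - y′ * y′
  4∣-subst refl refl = 4∣x²-y²
  even-odd : ∀ a b → (a * a - b * b - b) * + 4 - ((a + a) * (a + a) - (b + b + + 1) * (b + b + + 1)) ≡ + 1
  even-odd = solve-∀
  odd-even : ∀ a b → ((a + a + + 1) * (a + a + + 1) - (b + b) * (b + b)) - (a * a + a - b * b) * + 4 ≡ + 1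
  odd-even = solve-∀
  sum₀ : ∀ a b → a + a ≡ (a + b) + (a - b)
  sum₀ = solve-∀
  difference₀ : ∀ a b → b + b ≡ (a + b) - (a - b)
  difference₀ = solve-∀
  sum₁ : ∀ a b → a + a + + 1 ≡ (a + b + + 1) + (a - b)
  sum₁ = solve-∀
  difference₁ : ∀ a b → b + b + + 1 ≡ (a + b + + 1) - (a - b)
  difference₁ = solve-∀
  combine : ∃[ a ] (x ≡ a + a ⊎ x ≡ a + a + + 1) → ∃[ b ] (y ≡ b + b ⊎ y ≡ b + b + + 1) →
    ∃[ k ] ∃[ l ] x ≡ k + l × y ≡ k - l
  combine (a , inj₁ x≡) (b , inj₁ y≡) = a + b , a - b , trans x≡ (sum₀ a b) , trans y≡ (difference₀ a b)
  combine (a , inj₂ x≡) (b , inj₂ y≡) =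
    a + b + + 1 , a - b , trans x≡ (sum₁ a b) , trans y≡ (difference₁ a b)
  combine (a , inj₁ x≡) (b , inj₂ y≡) =
    contradiction
      (subst (+ 4 ∣_) (even-odd a b) (∣m∣n⇒∣m-n (divides (a * a - b * b - b) refl) (4∣-subst x≡ y≡))) 4∤1
  combine (a , inj₂ x≡) (b , inj₁ y≡) =
    contradiction
      (subst (+ 4 ∣_) (odd-even a b) (∣m∣n⇒∣m-n (4∣-subst x≡ y≡) (divides (a * a + a - b * b) refl))) 4∤1

≤-1⇒< : ∀ {X} K → + X ≤ + K - + 1 → X ℕ.< K
≤-1⇒< zero    ()
≤-1⇒< (suc K) (+≤+ X≤K) = ℕ.s≤s X≤K

multiple<self⇒0 : ∀ q K → q ℕ.* K ℕ.< K → q ≡ 0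
multiple<self⇒0 zero    K _  = refl
multiple<self⇒0 (suc q) K lt = contradiction (ℕ.m≤m+n K (q ℕ.* K)) (ℕ.<⇒≱ lt)

residue-unique : ∀ {x x′} m r → + 0 ≤ x → x ≤ + 2 * + ∣ m ∣ - + 1 →
  + 0 ≤ x′ → x′ ≤ + 2 * + ∣ m ∣ - + 1 → x′ ≡ x - + 2 * r * m → x ≡ x′
residue-unique {+ X} {+ X′} m r _ x≤ _ x′≤ x′≡ = sym (begin
  + X′                  ≡⟨ x′≡ ⟩
  + X - + 2 * r * m     ≡⟨ cong (λ z → + X - + 2 * z * m) r≡0 ⟩
  + X - + 2 * + 0 * m   ≡⟨ ℤ.+-identityʳ (+ X) ⟩
  + X                   ∎)
  where
  identity : ∀ x r m → x - (x - + 2 * r * m) ≡ r * (+ 2 * m)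
  identity = solve-∀
  bound : ∀ {Y} → + Y ≤ + 2 * + ∣ m ∣ - + 1 → Y ℕ.< 2 ℕ.* ∣ m ∣
  bound {Y} le = ≤-1⇒< (2 ℕ.* ∣ m ∣) (subst (λ z → + Y ≤ z - + 1) (sym (ℤ.pos-* 2 ∣ m ∣)) le)
  distance : ∣ X ⊖ X′ ∣ ≡ ∣ r ∣ ℕ.* (2 ℕ.* ∣ m ∣)
  distance = begin
    ∣ X ⊖ X′ ∣                    ≡⟨ cong ∣_∣ (ℤ.m-n≡m⊖n X X′) ⟨
    ∣ + X - + X′ ∣                ≡⟨ cong (λ z → ∣ + X - z ∣) x′≡ ⟩
    ∣ + X - (+ X - + 2 * r * m) ∣ ≡⟨ cong ∣_∣ (identity (+ X) r m) ⟩
    ∣ r * (+ 2 * m) ∣             ≡⟨ ℤ.abs-* r (+ 2 * m) ⟩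
    ∣ r ∣ ℕ.* ∣ + 2 * m ∣         ≡⟨ cong (∣ r ∣ ℕ.*_) (ℤ.abs-* (+ 2) m) ⟩
    ∣ r ∣ ℕ.* (2 ℕ.* ∣ m ∣)       ∎
  r≡0 : r ≡ + 0
  r≡0 = ℤ.∣i∣≡0⇒i≡0 (multiple<self⇒0 ∣ r ∣ (2 ℕ.* ∣ m ∣)
    (subst (ℕ._< 2 ℕ.* ∣ m ∣) distance
      (ℕ.≤-<-trans (ℤ.∣m⊝n∣≤m⊔n X X′) (ℕ.⊔-pres-<m (bound x≤) (bound x′≤)))))

natural-combination : ∀ {d} x y a b σ τ → d ℕ.+ y ℕ.* ∣ b ∣ ≡ x ℕ.* ∣ a ∣ →
  + ∣ a ∣ ≡ σ * a → + ∣ b ∣ ≡ τ * b → (+ x * σ) * a + (- (+ y * τ)) * b ≡ + d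
natural-combination {d} x y a b σ τ eq |a|≡σa |b|≡τb = begin
  (+ x * σ) * a + (- (+ y * τ)) * b       ≡⟨ regroup (+ x) (+ y) σ τ a b ⟩
  + x * (σ * a) - + y * (τ * b)           ≡⟨ cong₂ (λ p q → + x * p - + y * q) (sym |a|≡σa) (sym |b|≡τb) ⟩
  + x * + ∣ a ∣ - + y * + ∣ b ∣           ≡⟨ cong₂ _-_ (sym (ℤ.pos-* x ∣ a ∣)) (sym (ℤ.pos-* y ∣ b ∣)) ⟩
  + (x ℕ.* ∣ a ∣) - + (y ℕ.* ∣ b ∣)       ≡⟨ cong (λ z → + z - + (y ℕ.* ∣ b ∣)) (sym eq) ⟩
  + (d ℕ.+ y ℕ.* ∣ b ∣) - + (y ℕ.* ∣ b ∣) ≡⟨ cong (_- + (y ℕ.* ∣ b ∣)) (ℤ.pos-+ d (y ℕ.* ∣ b ∣)) ⟩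
  + d + + (y ℕ.* ∣ b ∣) - + (y ℕ.* ∣ b ∣) ≡⟨ cancel (+ d) (+ (y ℕ.* ∣ b ∣)) ⟩
  + d                                     ∎
  where
  regroup : ∀ x y σ τ a b → (x * σ) * a + (- (y * τ)) * b ≡ x * (σ * a) - y * (τ * b)
  regroup = solve-∀
  cancel : ∀ p q → p + q - q ≡ p
  cancel = solve-∀

gcd-combination : ∀ a b → ∃[ u ] ∃[ v ] u * a + v * b ≡ gcd a b
gcd-combination a b with Bézout.identity (gcd-GCD ∣ a ∣ ∣ b ∣) | m∣∣m∣ {a} | m∣∣m∣ {b}
... | Bézout.+- x y eq | divides σ |a|≡σa | divides τ |b|≡τb =
  + x * σ , - (+ y * τ) , natural-combination x y a b σ τ eq |a|≡σa |b|≡τb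
... | Bézout.-+ x y eq | divides σ |a|≡σa | divides τ |b|≡τb =
  - (+ x * σ) , + y * τ ,
  trans (ℤ.+-comm ((- (+ x * σ)) * a) ((+ y * τ) * b))
        (natural-combination y x b a τ σ eq |b|≡τb |a|≡σa)

-- Abstract: matching on the result must not make the type checker unfold
-- the gcd computation behind g, which is prohibitively slow.
abstract
  bézout₃ : ∀ a b c → ∃[ g ] (g ∣ a) × (g ∣ b) × (g ∣ c) ×
    ∃[ u ] ∃[ v ] ∃[ w ] u * a + v * b + w * c ≡ g
  bézout₃ a b c with gcd-combination a b | gcd-combination (gcd a b) c
  ... | u , v , e₁ | u′ , w , e₂ =
    gcd (gcd a b) c ,
    ∣-trans g∣gcd[a,b] (∣ᵤ⇒∣ (gcd[i,j]∣i a b)) ,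
    ∣-trans g∣gcd[a,b] (∣ᵤ⇒∣ (gcd[i,j]∣j a b)) ,
    ∣ᵤ⇒∣ (gcd[i,j]∣j (gcd a b) c) ,
    u′ * u , u′ * v , w , (begin
      u′ * u * a + u′ * v * b + w * c  ≡⟨ regroup u′ u v w a b c ⟩
      u′ * (u * a + v * b) + w * c     ≡⟨ cong (λ z → u′ * z + w * c) e₁ ⟩
      u′ * gcd a b + w * c             ≡⟨ e₂ ⟩
      gcd (gcd a b) c                  ∎)
    where
    g∣gcd[a,b] : gcd (gcd a b) c ∣ gcd a b
    g∣gcd[a,b] = ∣ᵤ⇒∣ (gcd[i,j]∣i (gcd a b) c)
    regroup : ∀ u′ u v w a b c → u′ * u * a + u′ * v * b + w * c ≡ u′ * (u * a + v * b) + w * c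
    regroup = solve-∀

record PrimitiveFactorisation (m n k : ℤ) : Set where
  field
    g m′ n′ k′ u v w : ℤ
    g≢0 : g ≢ + 0
    m≡m′g : m ≡ m′ * g
    n≡n′g : n ≡ n′ * g
    k≡k′g : k ≡ k′ * g
    unimodular : u * m′ + v * n′ + w * k′ ≡ + 1

primitiveFactorisation : ∀ m n k → m ≢ + 0 → PrimitiveFactorisation m n k
primitiveFactorisation m n k m≢0 with bézout₃ m n k
... | g , divides m′ m≡m′g , divides n′ n≡n′g , divides k′ k≡k′g , u , v , w , comb = record
  { g = g ; m′ = m′ ; n′ = n′ ; k′ = k′ ; u = u ; v = v ; w = w
  ; m≡m′g = m≡m′g ; n≡n′g = n≡n′g ; k≡k′g = k≡k′g ; g≢0 = g≢0
  ; unimodular = *-cancelˡ-≢0 g g≢0 (begin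
      g * (u * m′ + v * n′ + w * k′)      ≡⟨ regroup g u v w m′ n′ k′ ⟩
      u * (m′ * g) + v * (n′ * g) + w * (k′ * g)
        ≡⟨ cong₂ (λ p q → p + w * q) (cong₂ (λ p q → u * p + v * q) (sym m≡m′g) (sym n≡n′g)) (sym k≡k′g) ⟩
      u * m + v * n + w * k               ≡⟨ comb ⟩
      g                                   ≡⟨ ℤ.*-identityʳ g ⟨
      g * + 1                             ∎) }
  where
  g≢0 : g ≢ + 0
  g≢0 g≡0 = m≢0 (trans m≡m′g (trans (cong (m′ *_) g≡0) (ℤ.*-zeroʳ m′)))
  regroup : ∀ g u v w m′ n′ k′ →
    g * (u * m′ + v * n′ + w * k′) ≡ u * (m′ * g) + v * (n′ * g) + w * (k′ * g)
  regroup = solve-∀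

-- Binary quadratic forms

Form : Set
Form = ℤ × ℤ × ℤ

form : Form → ℤ → ℤ → ℤ
form (α , β , γ) u v = α * u * u + β * u * v + γ * v * v

discriminant : Form → ℤ
discriminant (α , β , γ) = β * β - + 4 * α * γ

-- The coefficients of the form (u , v) ↦ form p (u - r * v) v.
shear : ℤ → Form → Form
shear r (α , β , γ) = α , β - + 2 * r * α , γ - r * β + r * r * α

_⊙_ : ℤ × ℤ × ℤ → Form → ℤ
(l₁ , l₂ , l₃) ⊙ (α , β , γ) = l₁ * α + l₂ * β + l₃ * γ

Primitive : Form → Set
Primitive p = ∃[ l ] l ⊙ p ≡ + 1

form-injective : ∀ p q → (∀ u v → form p u v ≡ form q u v) → p ≡ q
form-injective (α , β , γ) (α′ , β′ , γ′) same = cong-triple α≡α′ β≡β′ γ≡γ′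
  where
  at10 : ∀ α β γ → α * + 1 * + 1 + β * + 1 * + 0 + γ * + 0 * + 0 ≡ α
  at10 = solve-∀
  at01 : ∀ α β γ → α * + 0 * + 0 + β * + 0 * + 1 + γ * + 1 * + 1 ≡ γ
  at01 = solve-∀
  at11 : ∀ α β γ → α * + 1 * + 1 + β * + 1 * + 1 + γ * + 1 * + 1 ≡ β + (α + γ)
  at11 = solve-∀
  α≡α′ : α ≡ α′
  α≡α′ = trans (sym (at10 α β γ)) (trans (same (+ 1) (+ 0)) (at10 α′ β′ γ′))
  γ≡γ′ : γ ≡ γ′
  γ≡γ′ = trans (sym (at01 α β γ)) (trans (same (+ 0) (+ 1)) (at01 α′ β′ γ′))
  β≡β′ : β ≡ β′
  β≡β′ = +-cancelʳ (α + γ) β β′ (begin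
    β + (α + γ)    ≡⟨ trans (sym (at11 α β γ)) (trans (same (+ 1) (+ 1)) (at11 α′ β′ γ′)) ⟩
    β′ + (α′ + γ′) ≡⟨ cong (λ z → β′ + z) (cong₂ _+_ α≡α′ γ≡γ′) ⟨
    β′ + (α + γ)   ∎)

discriminant-cancel : ∀ {m} x s s′ → m ≢ + 0 →
  discriminant (m , x , s) ≡ discriminant (m , x , s′) → s ≡ s′
discriminant-cancel {m} x s s′ m≢0 eq =
  *-cancelˡ-≢0 m m≢0 (*-cancelˡ-≢0 (+ 4) (λ ())
    (trans (sym (reassoc m s)) (trans 4ms≡4ms′ (reassoc m s′))))
  where
  reassoc : ∀ m s → + 4 * m * s ≡ + 4 * (m * s)
  reassoc = solve-∀
  4ms≡4ms′ : + 4 * m * s ≡ + 4 * m * s′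
  4ms≡4ms′ = ℤ.neg-injective (+-cancelˡ (x * x) _ _ eq)

squareFree⇒primitive : ∀ p → SquareFree (discriminant p) → Primitive p
squareFree⇒primitive (α , β , γ) squareFree with bézout₃ α β γ
... | g , divides α′ α≡α′g , divides β′ β≡β′g , divides γ′ γ≡γ′g , u , v , w , comb =
  (g * u , g * v , g * w) , (begin
    g * u * α + g * v * β + g * w * γ ≡⟨ factor g u v w α β γ ⟩
    g * (u * α + v * β + w * γ)       ≡⟨ cong (g *_) comb ⟩
    g * g                             ≡⟨ ∣i∣≡1⇒i*i≡1 g (squareFree g g²∣disc) ⟩
    + 1                               ∎)
  where
  factor : ∀ g u v w α β γ → g * u * α + g * v * β + g * w * γ ≡ g * (u * α + v * β + w * γ)
  factor = solve-∀
  scale : ∀ g α β γ → (β * g) * (β * g) - + 4 * (α * g) * (γ * g) ≡ (β * β - + 4 * α * γ) * (g * g)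
  scale = solve-∀
  g²∣disc : (g * g) Unsigned.∣ discriminant (α , β , γ)
  g²∣disc = ∣⇒∣ᵤ (divides (discriminant (α′ , β′ , γ′))
    (trans (cong discriminant (cong-triple α≡α′g β≡β′g γ≡γ′g)) (scale g α′ β′ γ′)))

-- Vectors in ℤ² and their wedge product

V : Set
V = ℤ × ℤ

infix  7 _∧_
infixr 7 _·_ _·ᴹ_
infixl 6 _⊕_ _+ᴹ_

_∧_ : V → V → ℤ
(u₁ , u₂) ∧ (w₁ , w₂) = u₁ * w₂ - u₂ * w₁

_·_ : ℤ → V → V
k · (u₁ , u₂) = k * u₁ , k * u₂

_⊕_ : V → V → V
(u₁ , u₂) ⊕ (w₁ , w₂) = u₁ + w₁ , u₂ + w₂

apply : Mat2 → V → V
apply (mat p q r s) (u₁ , u₂) = p * u₁ + q * u₂ , r * u₁ + s * u₂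

∧-self : ∀ u → u ∧ u ≡ + 0
∧-self (u₁ , u₂) = identity u₁ u₂
  where
  identity : ∀ u₁ u₂ → u₁ * u₂ - u₂ * u₁ ≡ + 0
  identity = solve-∀

∧-antisym : ∀ u w → w ∧ u ≡ - (u ∧ w)
∧-antisym (u₁ , u₂) (w₁ , w₂) = identity u₁ u₂ w₁ w₂
  where
  identity : ∀ u₁ u₂ w₁ w₂ → w₁ * u₂ - w₂ * u₁ ≡ - (u₁ * w₂ - u₂ * w₁)
  identity = solve-∀

det-∧ : ∀ M u w → det M * (u ∧ w) ≡ apply M u ∧ apply M w
det-∧ (mat p q r s) (u₁ , u₂) (w₁ , w₂) = identity p q r s u₁ u₂ w₁ w₂
  where
  identity : ∀ p q r s u₁ u₂ w₁ w₂ → (p * s - q * r) * (u₁ * w₂ - u₂ * w₁)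
    ≡ (p * u₁ + q * u₂) * (r * w₁ + s * w₂) - (r * u₁ + s * u₂) * (p * w₁ + q * w₂)
  identity = solve-∀

cramer : ∀ u w z → (u ∧ w) · z ≡ (z ∧ w) · u ⊕ (u ∧ z) · w
cramer (u₁ , u₂) (w₁ , w₂) (z₁ , z₂) =
  cong₂ _,_ (first u₁ u₂ w₁ w₂ z₁ z₂) (second u₁ u₂ w₁ w₂ z₁ z₂)
  where
  first : ∀ u₁ u₂ w₁ w₂ z₁ z₂ →
    (u₁ * w₂ - u₂ * w₁) * z₁ ≡ (z₁ * w₂ - z₂ * w₁) * u₁ + (u₁ * z₂ - u₂ * z₁) * w₁
  first = solve-∀
  second : ∀ u₁ u₂ w₁ w₂ z₁ z₂ →
    (u₁ * w₂ - u₂ * w₁) * z₂ ≡ (z₁ * w₂ - z₂ * w₁) * u₂ + (u₁ * z₂ - u₂ * z₁) * w₂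
  second = solve-∀

-- By Cramer's rule, exchange u w u′ w′ sends u to (u ∧ w) · u′ and w to (u ∧ w) · w′.
exchange : V → V → V → V → Mat2
exchange (u₁ , u₂) (w₁ , w₂) (u₁′ , u₂′) (w₁′ , w₂′) =
  mat (u₁′ * w₂ - w₁′ * u₂) (w₁′ * u₁ - u₁′ * w₁) (u₂′ * w₂ - w₂′ * u₂) (w₂′ * u₁ - u₂′ * w₁)

apply-exchange : ∀ u w u′ w′ z → apply (exchange u w u′ w′) z ≡ (z ∧ w) · u′ ⊕ (u ∧ z) · w′
apply-exchange (u₁ , u₂) (w₁ , w₂) (u₁′ , u₂′) (w₁′ , w₂′) (z₁ , z₂) =
  cong₂ _,_ (identity u₁ u₂ w₁ w₂ u₁′ w₁′ z₁ z₂) (identity u₁ u₂ w₁ w₂ u₂′ w₂′ z₁ z₂)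
  where
  identity : ∀ u₁ u₂ w₁ w₂ u′ w′ z₁ z₂ →
    (u′ * w₂ - w′ * u₂) * z₁ + (w′ * u₁ - u′ * w₁) * z₂
      ≡ (z₁ * w₂ - z₂ * w₁) * u′ + (u₁ * z₂ - u₂ * z₁) * w′
  identity = solve-∀

_+ᴹ_ : Mat2 → Mat2 → Mat2
mat p q r s +ᴹ mat p′ q′ r′ s′ = mat (p + p′) (q + q′) (r + r′) (s + s′)

_·ᴹ_ : ℤ → Mat2 → Mat2
k ·ᴹ mat p q r s = mat (k * p) (k * q) (k * r) (k * s)

0ᴹ : Mat2
0ᴹ = mat (+ 0) (+ 0) (+ 0) (+ 0)

apply-linear : ∀ c M N z → apply (c ·ᴹ M +ᴹ N) z ≡ c · apply M z ⊕ apply N z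
apply-linear c (mat p q r s) (mat p′ q′ r′ s′) (z₁ , z₂) =
  cong₂ _,_ (identity c p q p′ q′ z₁ z₂) (identity c r s r′ s′ z₁ z₂)
  where
  identity : ∀ c p q p′ q′ z₁ z₂ →
    (c * p + p′) * z₁ + (c * q + q′) * z₂ ≡ c * (p * z₁ + q * z₂) + (p′ * z₁ + q′ * z₂)
  identity = solve-∀

·-⊕-distrib : ∀ c b B z → c · (b · z) ⊕ B · z ≡ (c * b + B) · z
·-⊕-distrib c b B (z₁ , z₂) = cong₂ _,_ (identity c b B z₁) (identity c b B z₂)
  where
  identity : ∀ c b B z → c * (b * z) + B * z ≡ (c * b + B) * z
  identity = solve-∀

·-identityˡ : ∀ z → + 1 · z ≡ z
·-identityˡ (z₁ , z₂) = cong₂ _,_ (ℤ.*-identityˡ z₁) (ℤ.*-identityˡ z₂)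

Combination : Set → Set
Combination I = List (ℤ × I × I)

module _ {I : Set} where

  weightedWedge : (I → V) → Combination I → ℤ
  weightedWedge v []                  = + 0
  weightedWedge v ((c , i , j) ∷ cs) = c * (v i ∧ v j) + weightedWedge v cs

  weightedWedge-cong : ∀ {v w : I → V} → (∀ i j → v i ∧ v j ≡ w i ∧ w j) →
    ∀ cs → weightedWedge v cs ≡ weightedWedge w cs
  weightedWedge-cong same []                  = refl
  weightedWedge-cong same ((c , i , j) ∷ cs) =
    cong₂ (λ p q → c * p + q) (same i j) (weightedWedge-cong same cs)

  det-weightedWedge : ∀ M (v : I → V) cs →
    det M * weightedWedge v cs ≡ weightedWedge (apply M ∘ v) cs
  det-weightedWedge M v []                  = ℤ.*-zeroʳ (det M)
  det-weightedWedge M v ((c , i , j) ∷ cs) = begin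
    det M * (c * (v i ∧ v j) + weightedWedge v cs)
      ≡⟨ distrib (det M) c (v i ∧ v j) (weightedWedge v cs) ⟩
    c * (det M * (v i ∧ v j)) + det M * weightedWedge v cs
      ≡⟨ cong₂ (λ p q → c * p + q) (det-∧ M (v i) (v j)) (det-weightedWedge M v cs) ⟩
    c * (apply M (v i) ∧ apply M (v j)) + weightedWedge (apply M ∘ v) cs ∎
    where
    distrib : ∀ d c b r → d * (c * b + r) ≡ c * (d * b) + d * r
    distrib = solve-∀

  transport : (v w : I → V) → Combination I → Mat2
  transport v w []                  = 0ᴹ
  transport v w ((c , i , j) ∷ cs) = c ·ᴹ exchange (v i) (v j) (w i) (w j) +ᴹ transport v w cs

  apply-transport : ∀ {v w : I → V} → (∀ i j → v i ∧ v j ≡ w i ∧ w j) →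
    ∀ cs k → apply (transport v w cs) (v k) ≡ weightedWedge w cs · w k
  apply-transport same []                  k = refl
  apply-transport {v} {w} same ((c , i , j) ∷ cs) k = begin
    apply (c ·ᴹ exchange (v i) (v j) (w i) (w j) +ᴹ transport v w cs) (v k)
      ≡⟨ apply-linear c _ _ (v k) ⟩
    c · apply (exchange (v i) (v j) (w i) (w j)) (v k) ⊕ apply (transport v w cs) (v k)
      ≡⟨ cong₂ (λ p q → c · p ⊕ q) (apply-exchange (v i) (v j) (w i) (w j) (v k))
                                    (apply-transport same cs k) ⟩
    c · ((v k ∧ v j) · w i ⊕ (v i ∧ v k) · w j) ⊕ weightedWedge w cs · w k
      ≡⟨ cong (λ p → c · p ⊕ weightedWedge w cs · w k)
              (trans (cong₂ (λ p q → p · w i ⊕ q · w j) (same k j) (same i k))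
                     (sym (cramer (w i) (w j) (w k)))) ⟩
    c · ((w i ∧ w j) · w k) ⊕ weightedWedge w cs · w k
      ≡⟨ ·-⊕-distrib c (w i ∧ w j) (weightedWedge w cs) (w k) ⟩
    (c * (w i ∧ w j) + weightedWedge w cs) · w k ∎

  equal-wedges⇒SL₂-related : (v w : I → V) → (∀ i j → v i ∧ v j ≡ w i ∧ w j) →
    ∀ cs → weightedWedge v cs ≡ + 1 →
    Σ Mat2 λ G → InSL2 G × (∀ k → apply G (v k) ≡ w k)
  equal-wedges⇒SL₂-related v w same cs unit = G , det≡1 , G-maps
    where
    G : Mat2
    G = transport v w cs
    unit′ : weightedWedge w cs ≡ + 1
    unit′ = trans (sym (weightedWedge-cong same cs)) unit
    G-maps : ∀ k → apply G (v k) ≡ w k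
    G-maps k = trans (apply-transport same cs k)
                     (trans (cong (_· w k) unit′) (·-identityˡ (w k)))
    det≡1 : det G ≡ + 1
    det≡1 = begin
      det G                          ≡⟨ ℤ.*-identityʳ (det G) ⟨
      det G * + 1                    ≡⟨ cong (det G *_) unit ⟨
      det G * weightedWedge v cs     ≡⟨ det-weightedWedge G v cs ⟩
      weightedWedge (apply G ∘ v) cs ≡⟨ weightedWedge-cong (λ i j → cong₂ _∧_ (G-maps i) (G-maps j)) cs ⟩
      weightedWedge w cs             ≡⟨ unit′ ⟩
      + 1                            ∎

-- The columns of a cube and the coefficients of Q₁ and Q₂

data Column : Set where
  ac bd eg fh : Column

column : Cube → Column → V
column (cube a b c d e f g h) ac = a , c
column (cube a b c d e f g h) bd = b , d
column (cube a b c d e f g h) eg = e , g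
column (cube a b c d e f g h) fh = f , h

wedge : Cube → Column → Column → ℤ
wedge A i j = column A i ∧ column A j

Q₁-coefficients : Cube → Form
Q₁-coefficients (cube a b c d e f g h) =
  a * d - b * c , - (a * h) + b * g + c * f - d * e , e * h - f * g

Q₂-coefficients : Cube → Form
Q₂-coefficients (cube a b c d e f g h) =
  a * g - c * e , - (a * h) - b * g + c * f + d * e , b * h - d * f

transposed-form : ∀ α β γ u v → u * u * α + u * v * β + v * v * γ ≡ α * u * u + β * u * v + γ * v * v
transposed-form = solve-∀

Q₁-form : ∀ A u v → Q₁ A u v ≡ form (Q₁-coefficients A) u v
Q₁-form (cube a b c d e f g h) =
  transposed-form (a * d - b * c) (- (a * h) + b * g + c * f - d * e) (e * h - f * g)

Q₂-form : ∀ A u v → Q₂ A u v ≡ form (Q₂-coefficients A) u v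
Q₂-form (cube a b c d e f g h) =
  transposed-form (a * g - c * e) (- (a * h) - b * g + c * f + d * e) (b * h - d * f)

disc≡discriminant-Q₁ : ∀ A → disc A ≡ discriminant (Q₁-coefficients A)
disc≡discriminant-Q₁ (cube a b c d e f g h) = refl

disc≡discriminant-Q₂ : ∀ A → disc A ≡ discriminant (Q₂-coefficients A)
disc≡discriminant-Q₂ (cube a b c d e f g h) = identity a b c d e f g h
  where
  identity : ∀ a b c d e f g h →
    (- (a * h) + b * g + c * f - d * e) * (- (a * h) + b * g + c * f - d * e)
      - + 4 * (a * d - b * c) * (e * h - f * g)
    ≡ (- (a * h) - b * g + c * f + d * e) * (- (a * h) - b * g + c * f + d * e)
      - + 4 * (a * g - c * e) * (b * h - d * f)
  identity = solve-∀

Q₁-coefficients-wedges : ∀ A →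
  Q₁-coefficients A ≡ (wedge A ac bd , wedge A bd eg - wedge A ac fh , wedge A eg fh)
Q₁-coefficients-wedges (cube a b c d e f g h) =
  cong-triple (det-swap a b c d) (middle a b c d e f g h) (det-swap e f g h)
  where
  det-swap : ∀ a b c d → a * d - b * c ≡ a * d - c * b
  det-swap = solve-∀
  middle : ∀ a b c d e f g h →
    - (a * h) + b * g + c * f - d * e ≡ (b * g - d * e) - (a * h - c * f)
  middle = solve-∀

Q₂-coefficients-wedges : ∀ A →
  Q₂-coefficients A ≡ (wedge A ac eg , - wedge A ac fh - wedge A bd eg , wedge A bd fh)
Q₂-coefficients-wedges (cube a b c d e f g h) = cong-triple refl (middle a b c d e f g h) refl
  where
  middle : ∀ a b c d e f g h →
    - (a * h) - b * g + c * f + d * e ≡ - (a * h - c * f) - (b * g - d * e)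
  middle = solve-∀

wedges-determine-coefficients : ∀ A A′ → (∀ i j → wedge A i j ≡ wedge A′ i j) →
  Q₁-coefficients A ≡ Q₁-coefficients A′ × Q₂-coefficients A ≡ Q₂-coefficients A′
wedges-determine-coefficients A A′ same =
  trans (Q₁-coefficients-wedges A)
    (trans (cong-triple (same ac bd) (cong₂ _-_ (same bd eg) (same ac fh)) (same eg fh))
           (sym (Q₁-coefficients-wedges A′))) ,
  trans (Q₂-coefficients-wedges A)
    (trans (cong-triple (same ac eg) (cong₂ (λ p q → - p - q) (same ac fh) (same bd eg)) (same bd fh))
           (sym (Q₂-coefficients-wedges A′)))

module _ (v w : Column → V)
  (ac-bd : v ac ∧ v bd ≡ w ac ∧ w bd) (ac-eg : v ac ∧ v eg ≡ w ac ∧ w eg)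
  (ac-fh : v ac ∧ v fh ≡ w ac ∧ w fh) (bd-eg : v bd ∧ v eg ≡ w bd ∧ w eg)
  (bd-fh : v bd ∧ v fh ≡ w bd ∧ w fh) (eg-fh : v eg ∧ v fh ≡ w eg ∧ w fh) where

  private
    diagonal : ∀ i → v i ∧ v i ≡ w i ∧ w i
    diagonal i = trans (∧-self (v i)) (sym (∧-self (w i)))
    swapped : ∀ i j → v i ∧ v j ≡ w i ∧ w j → v j ∧ v i ≡ w j ∧ w i
    swapped i j eq = trans (∧-antisym (v i) (v j)) (trans (cong -_ eq) (sym (∧-antisym (w i) (w j))))

  wedges-agree : ∀ i j → v i ∧ v j ≡ w i ∧ w j
  wedges-agree ac ac = diagonal ac
  wedges-agree ac bd = ac-bd
  wedges-agree ac eg = ac-eg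
  wedges-agree ac fh = ac-fh
  wedges-agree bd ac = swapped ac bd ac-bd
  wedges-agree bd bd = diagonal bd
  wedges-agree bd eg = bd-eg
  wedges-agree bd fh = bd-fh
  wedges-agree eg ac = swapped ac eg ac-eg
  wedges-agree eg bd = swapped bd eg bd-eg
  wedges-agree eg eg = diagonal eg
  wedges-agree eg fh = eg-fh
  wedges-agree fh ac = swapped ac fh ac-fh
  wedges-agree fh bd = swapped bd fh bd-fh
  wedges-agree fh eg = swapped eg fh eg-fh
  wedges-agree fh fh = diagonal fh

coefficients-determine-wedges : ∀ A A′ → Q₁-coefficients A ≡ Q₁-coefficients A′ →
  Q₂-coefficients A ≡ Q₂-coefficients A′ → ∀ i j → wedge A i j ≡ wedge A′ i j
coefficients-determine-wedges A A′ same₁ same₂ =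
  wedges-agree (column A) (column A′)
    (first same₁′) (first same₂′) (proj₂ middles) (proj₁ middles) (last same₂′) (last same₁′)
  where
  same₁′ : (wedge A ac bd , wedge A bd eg - wedge A ac fh , wedge A eg fh)
         ≡ (wedge A′ ac bd , wedge A′ bd eg - wedge A′ ac fh , wedge A′ eg fh)
  same₁′ = trans (sym (Q₁-coefficients-wedges A)) (trans same₁ (Q₁-coefficients-wedges A′))
  same₂′ : (wedge A ac eg , - wedge A ac fh - wedge A bd eg , wedge A bd fh)
         ≡ (wedge A′ ac eg , - wedge A′ ac fh - wedge A′ bd eg , wedge A′ bd fh)
  same₂′ = trans (sym (Q₂-coefficients-wedges A)) (trans same₂ (Q₂-coefficients-wedges A′))
  first : ∀ {p q : Form} → p ≡ q → proj₁ p ≡ proj₁ q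
  first = cong proj₁
  last : ∀ {p q : Form} → p ≡ q → proj₂ (proj₂ p) ≡ proj₂ (proj₂ q)
  last = cong (proj₂ ∘ proj₂)
  middles : wedge A bd eg ≡ wedge A′ bd eg × wedge A ac fh ≡ wedge A′ ac fh
  middles = sum-difference-cancel (cong (proj₁ ∘ proj₂) same₁′) (cong (proj₁ ∘ proj₂) same₂′)
    where
    twice : ∀ B C → + 2 * B ≡ (B - C) - (- C - B)
    twice = solve-∀
    twice′ : ∀ B C → + 2 * C ≡ - ((B - C) + (- C - B))
    twice′ = solve-∀
    sum-difference-cancel : ∀ {B C B′ C′} → B - C ≡ B′ - C′ → - C - B ≡ - C′ - B′ → B ≡ B′ × C ≡ C′
    sum-difference-cancel {B} {C} {B′} {C′} e₁ e₂ =
      *-cancelˡ-≢0 (+ 2) (λ ()) (trans (twice B C) (trans (cong₂ _-_ e₁ e₂) (sym (twice B′ C′)))) ,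
      *-cancelˡ-≢0 (+ 2) (λ ())
        (trans (twice′ B C) (trans (cong₂ (λ p q → - (p + q)) e₁ e₂) (sym (twice′ B′ C′))))

-- The action of the three factors

column-act₃ : ∀ G A k → column (act₃ G A) k ≡ apply G (column A k)
column-act₃ (mat _ _ _ _) (cube _ _ _ _ _ _ _ _) ac = refl
column-act₃ (mat _ _ _ _) (cube _ _ _ _ _ _ _ _) bd = refl
column-act₃ (mat _ _ _ _) (cube _ _ _ _ _ _ _ _) eg = refl
column-act₃ (mat _ _ _ _) (cube _ _ _ _ _ _ _ _) fh = refl

act₃-by-columns : ∀ G A A′ → (∀ k → apply G (column A k) ≡ column A′ k) → act₃ G A ≡ A′
act₃-by-columns (mat p q r s) (cube a b c d e f g h) (cube _ _ _ _ _ _ _ _) maps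
  with maps ac | maps bd | maps eg | maps fh
... | refl | refl | refl | refl = refl

SL₂-preserves-wedges : ∀ G A → InSL2 G → ∀ i j → wedge (act₃ G A) i j ≡ wedge A i j
SL₂-preserves-wedges G A det≡1 i j = begin
  column (act₃ G A) i ∧ column (act₃ G A) j ≡⟨ cong₂ _∧_ (column-act₃ G A i) (column-act₃ G A j) ⟩
  apply G (column A i) ∧ apply G (column A j) ≡⟨ det-∧ G (column A i) (column A j) ⟨
  det G * wedge A i j                         ≡⟨ cong (_* wedge A i j) det≡1 ⟩
  + 1 * wedge A i j                           ≡⟨ ℤ.*-identityˡ (wedge A i j) ⟩
  wedge A i j                                 ∎

SL₂-preserves-coefficients : ∀ G A → InSL2 G →
  Q₁-coefficients (act₃ G A) ≡ Q₁-coefficients A × Q₂-coefficients (act₃ G A) ≡ Q₂-coefficients A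
SL₂-preserves-coefficients G A det≡1 =
  wedges-determine-coefficients (act₃ G A) A (SL₂-preserves-wedges G A det≡1)

lower : ℤ → Mat2
lower r = mat (+ 1) (+ 0) r (+ 1)

lower∈B'₂ : ∀ r → InB'2 (lower r)
lower∈B'₂ r = refl , refl , +<+ (ℕ.s≤s ℕ.z≤n) , +<+ (ℕ.s≤s ℕ.z≤n)

B'₂⇒lower : ∀ {G} → InB'2 G → ∃[ r ] G ≡ lower r
B'₂⇒lower {mat (+ p) _ r (+ s)} (det≡1 , refl , _ , _) =
  r , cong₂ (λ p s → mat (+ p) (+ 0) r (+ s)) (ℕ.m*n≡1⇒m≡1 p s ps≡1) (ℕ.m*n≡1⇒n≡1 p s ps≡1)
  where
  ps≡1 : p ℕ.* s ≡ 1
  ps≡1 = ℤ.+-injective (trans (ℤ.pos-* p s) (trans (sym (ℤ.+-identityʳ (+ p * + s))) det≡1))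

cube-cong : ∀ {a b c d e f g h a′ b′ c′ d′ e′ f′ g′ h′} →
  a ≡ a′ → b ≡ b′ → c ≡ c′ → d ≡ d′ → e ≡ e′ → f ≡ f′ → g ≡ g′ → h ≡ h′ →
  cube a b c d e f g h ≡ cube a′ b′ c′ d′ e′ f′ g′ h′
cube-cong refl refl refl refl refl refl refl refl = refl

unit-row : ∀ a e → + 1 * a + + 0 * e ≡ a
unit-row = solve-∀

shear-row : ∀ r a e → r * a + + 1 * e ≡ r * a + e
shear-row = solve-∀

act₁-lower : ∀ r a b c d e f g h → act₁ (lower r) (cube a b c d e f g h)
  ≡ cube a b c d (r * a + e) (r * b + f) (r * c + g) (r * d + h)
act₁-lower r a b c d e f g h =
  cube-cong (unit-row a e) (unit-row b f) (unit-row c g) (unit-row d h)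
            (shear-row r a e) (shear-row r b f) (shear-row r c g) (shear-row r d h)

act₂-lower : ∀ r a b c d e f g h → act₂ (lower r) (cube a b c d e f g h)
  ≡ cube a (r * a + b) c (r * c + d) e (r * e + f) g (r * g + h)
act₂-lower r a b c d e f g h =
  cube-cong (unit-row a b) (shear-row r a b) (unit-row c d) (shear-row r c d)
            (unit-row e f) (shear-row r e f) (unit-row g h) (shear-row r g h)

sameOrbit-act₃ : ∀ G A A′ → InSL2 G → act₃ G A ≡ A′ → SameOrbit A A′
sameOrbit-act₃ G A A′ det≡1 maps =
  lower (+ 0) , lower (+ 0) , G , lower∈B'₂ (+ 0) , lower∈B'₂ (+ 0) , det≡1 ,
  trans (act₁-identity (act₂ (lower (+ 0)) (act₃ G A)))
        (trans (act₂-identity (act₃ G A)) maps)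
  where
  act₁-identity : ∀ B → act₁ (lower (+ 0)) B ≡ B
  act₁-identity (cube a b c d e f g h) = trans (act₁-lower (+ 0) a b c d e f g h)
    (cube-cong refl refl refl refl (ℤ.+-identityˡ e) (ℤ.+-identityˡ f) (ℤ.+-identityˡ g) (ℤ.+-identityˡ h))
  act₂-identity : ∀ B → act₂ (lower (+ 0)) B ≡ B
  act₂-identity (cube a b c d e f g h) = trans (act₂-lower (+ 0) a b c d e f g h)
    (cube-cong refl (ℤ.+-identityˡ b) refl (ℤ.+-identityˡ d) refl (ℤ.+-identityˡ f) refl (ℤ.+-identityˡ h))

act₁-lower-coefficients : ∀ r A →
  Q₁-coefficients (act₁ (lower r) A) ≡ shear r (Q₁-coefficients A) ×
  Q₂-coefficients (act₁ (lower r) A) ≡ Q₂-coefficients A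
act₁-lower-coefficients r (cube a b c d e f g h) =
  trans (cong Q₁-coefficients (act₁-lower r a b c d e f g h))
        (cong-triple refl (middle₁ a b c d e f g h r) (last₁ a b c d e f g h r)) ,
  trans (cong Q₂-coefficients (act₁-lower r a b c d e f g h))
        (cong-triple (first₂ a c e g r) (middle₂ a b c d e f g h r) (last₂ b d f h r))
  where
  middle₁ : ∀ a b c d e f g h r →
    - (a * (r * d + h)) + b * (r * c + g) + c * (r * b + f) - d * (r * a + e)
      ≡ (- (a * h) + b * g + c * f - d * e) - + 2 * r * (a * d - b * c)
  middle₁ = solve-∀
  last₁ : ∀ a b c d e f g h r →
    (r * a + e) * (r * d + h) - (r * b + f) * (r * c + g)
      ≡ (e * h - f * g) - r * (- (a * h) + b * g + c * f - d * e) + r * r * (a * d - b * c)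
  last₁ = solve-∀
  first₂ : ∀ a c e g r → a * (r * c + g) - c * (r * a + e) ≡ a * g - c * e
  first₂ = solve-∀
  middle₂ : ∀ a b c d e f g h r →
    - (a * (r * d + h)) - b * (r * c + g) + c * (r * b + f) + d * (r * a + e)
      ≡ - (a * h) - b * g + c * f + d * e
  middle₂ = solve-∀
  last₂ : ∀ b d f h r → b * (r * d + h) - d * (r * b + f) ≡ b * h - d * f
  last₂ = solve-∀

act₂-lower-coefficients : ∀ r A →
  Q₁-coefficients (act₂ (lower r) A) ≡ Q₁-coefficients A ×
  Q₂-coefficients (act₂ (lower r) A) ≡ shear r (Q₂-coefficients A)
act₂-lower-coefficients r (cube a b c d e f g h) =
  trans (cong Q₁-coefficients (act₂-lower r a b c d e f g h))
        (cong-triple (first₁ a b c d r) (middle₁ a b c d e f g h r) (last₁ e f g h r)) ,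
  trans (cong Q₂-coefficients (act₂-lower r a b c d e f g h))
        (cong-triple refl (middle₂ a b c d e f g h r) (last₂ a b c d e f g h r))
  where
  first₁ : ∀ a b c d r → a * (r * c + d) - (r * a + b) * c ≡ a * d - b * c
  first₁ = solve-∀
  middle₁ : ∀ a b c d e f g h r →
    - (a * (r * g + h)) + (r * a + b) * g + c * (r * e + f) - (r * c + d) * e
      ≡ - (a * h) + b * g + c * f - d * e
  middle₁ = solve-∀
  last₁ : ∀ e f g h r → e * (r * g + h) - (r * e + f) * g ≡ e * h - f * g
  last₁ = solve-∀
  middle₂ : ∀ a b c d e f g h r →
    - (a * (r * g + h)) - (r * a + b) * g + c * (r * e + f) + (r * c + d) * e
      ≡ (- (a * h) - b * g + c * f + d * e) - + 2 * r * (a * g - c * e)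
  middle₂ = solve-∀
  last₂ : ∀ a b c d e f g h r →
    (r * a + b) * (r * g + h) - (r * c + d) * (r * e + f)
      ≡ (b * h - d * f) - r * (- (a * h) - b * g + c * f + d * e) + r * r * (a * g - c * e)
  last₂ = solve-∀

orbit-shears : ∀ A A′ → SameOrbit A A′ → ∃[ r₁ ] ∃[ r₂ ]
  Q₁-coefficients A′ ≡ shear r₁ (Q₁-coefficients A) × Q₂-coefficients A′ ≡ shear r₂ (Q₂-coefficients A)
orbit-shears A _ (G₁ , G₂ , G₃ , G₁∈B'₂ , G₂∈B'₂ , det₃≡1 , refl)
  with B'₂⇒lower G₁∈B'₂ | B'₂⇒lower G₂∈B'₂
... | r₁ , refl | r₂ , refl = r₁ , r₂ , (begin
    Q₁-coefficients (act₁ (lower r₁) B₂)  ≡⟨ proj₁ (act₁-lower-coefficients r₁ B₂) ⟩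
    shear r₁ (Q₁-coefficients B₂)         ≡⟨ cong (shear r₁) (proj₁ (act₂-lower-coefficients r₂ B₃)) ⟩
    shear r₁ (Q₁-coefficients B₃)         ≡⟨ cong (shear r₁) (proj₁ (SL₂-preserves-coefficients G₃ A det₃≡1)) ⟩
    shear r₁ (Q₁-coefficients A)          ∎) , (begin
    Q₂-coefficients (act₁ (lower r₁) B₂)  ≡⟨ proj₂ (act₁-lower-coefficients r₁ B₂) ⟩
    Q₂-coefficients B₂                    ≡⟨ proj₂ (act₂-lower-coefficients r₂ B₃) ⟩
    shear r₂ (Q₂-coefficients B₃)         ≡⟨ cong (shear r₂) (proj₂ (SL₂-preserves-coefficients G₃ A det₃≡1)) ⟩
    shear r₂ (Q₂-coefficients A)          ∎)
  where
  B₃ B₂ : Cube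
  B₃ = act₃ G₃ A
  B₂ = act₂ (lower r₂) B₃

module _ {m n k : ℤ} (F : PrimitiveFactorisation m n k) (l s t : ℤ) where
  open PrimitiveFactorisation F

  primitive-relation : m * s - n * t ≡ k * l → m′ * s - n′ * t - k′ * l ≡ + 0
  primitive-relation relation = *-cancelˡ-≢0 g g≢0 (begin
    g * (m′ * s - n′ * t - k′ * l)        ≡⟨ distrib g m′ n′ k′ s t l ⟩
    m′ * g * s - n′ * g * t - k′ * g * l
      ≡⟨ cong₂ (λ p q → p - q * l) (cong₂ (λ p q → p * s - q * t) (sym m≡m′g) (sym n≡n′g)) (sym k≡k′g) ⟩
    m * s - n * t - k * l                 ≡⟨ ℤ.i≡j⇒i-j≡0 relation ⟩
    + 0                                   ≡⟨ ℤ.*-zeroʳ g ⟨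
    g * + 0                               ∎)
    where
    distrib : ∀ g m′ n′ k′ s t l → g * (m′ * s - n′ * t - k′ * l) ≡ m′ * g * s - n′ * g * t - k′ * g * l
    distrib = solve-∀

  -- The column (a, c) = (0, −g) has wedge products m, n and −k with the other
  -- three columns; the entries in positions d, g, h then solve the linear
  -- equations (b,d) ∧ (e,g) = l, (e,g) ∧ (f,h) = s, (b,d) ∧ (f,h) = t, which is
  -- possible because (m′, n′, k′) is unimodular and m′ s − n′ t = k′ l.
  explicitCube : Cube
  explicitCube = cube (+ 0) m′ (- g) (- (v * l) + w * t) n′ (- k′) (u * l + w * s) (u * t + v * s)

  explicitCube-coefficients : m * s - n * t ≡ k * l →
    Q₁-coefficients explicitCube ≡ (m , k + l , s) × Q₂-coefficients explicitCube ≡ (n , k - l , t)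
  explicitCube-coefficients relation =
    cong-triple (trans (first₁ g m′ (- (v * l) + w * t)) (sym m≡m′g))
                (trans (middle₁ g m′ n′ k′ u v w l s t) (collapse-k l w))
                (trans (last₁ m′ n′ k′ u v w l s t) (collapse s (- u))) ,
    cong-triple (trans (first₂ g n′ (u * l + w * s)) (sym n≡n′g))
                (trans (middle₂ g m′ n′ k′ u v w l s t) (collapse-k (- l) (- w)))
                (trans (last₂ m′ n′ k′ u v w l s t) (collapse t v))
    where
    collapse : ∀ c e → c * (u * m′ + v * n′ + w * k′) + e * (m′ * s - n′ * t - k′ * l) ≡ c
    collapse c e = trans (cong₂ (λ p q → c * p + e * q) unimodular (primitive-relation relation)) (drop c e)
      where
      drop : ∀ c e → c * + 1 + e * + 0 ≡ c
      drop = solve-∀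
    collapse-k : ∀ c e → k′ * g + (c * (u * m′ + v * n′ + w * k′) + e * (m′ * s - n′ * t - k′ * l)) ≡ k + c
    collapse-k c e = cong₂ _+_ (sym k≡k′g) (collapse c e)
    first₁ : ∀ g m′ z → + 0 * z - m′ * (- g) ≡ m′ * g
    first₁ = solve-∀
    first₂ : ∀ g n′ z → + 0 * z - (- g) * n′ ≡ n′ * g
    first₂ = solve-∀
    middle₁ : ∀ g m′ n′ k′ u v w l s t →
      - (+ 0 * (u * t + v * s)) + m′ * (u * l + w * s) + (- g) * (- k′) - (- (v * l) + w * t) * n′
        ≡ k′ * g + (l * (u * m′ + v * n′ + w * k′) + w * (m′ * s - n′ * t - k′ * l))
    middle₁ = solve-∀
    middle₂ : ∀ g m′ n′ k′ u v w l s t →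
      - (+ 0 * (u * t + v * s)) - m′ * (u * l + w * s) + (- g) * (- k′) + (- (v * l) + w * t) * n′
        ≡ k′ * g + (- l * (u * m′ + v * n′ + w * k′) + - w * (m′ * s - n′ * t - k′ * l))
    middle₂ = solve-∀
    last₁ : ∀ m′ n′ k′ u v w l s t →
      n′ * (u * t + v * s) - (- k′) * (u * l + w * s)
        ≡ s * (u * m′ + v * n′ + w * k′) + - u * (m′ * s - n′ * t - k′ * l)
    last₁ = solve-∀
    last₂ : ∀ m′ n′ k′ u v w l s t →
      m′ * (u * t + v * s) - (- (v * l) + w * t) * (- k′)
        ≡ t * (u * m′ + v * n′ + w * k′) + v * (m′ * s - n′ * t - k′ * l)
    last₂ = solve-∀

-- Cubes attached to solutions

Q₁-combination : ℤ × ℤ × ℤ → Combination Column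
Q₁-combination (l₁ , l₂ , l₃) = (l₁ , ac , bd) ∷ (l₂ , bd , eg) ∷ (- l₂ , ac , fh) ∷ (l₃ , eg , fh) ∷ []

weightedWedge-Q₁-combination : ∀ A l →
  weightedWedge (column A) (Q₁-combination l) ≡ l ⊙ Q₁-coefficients A
weightedWedge-Q₁-combination A (l₁ , l₂ , l₃) =
  trans (identity l₁ l₂ l₃ (wedge A ac bd) (wedge A bd eg) (wedge A ac fh) (wedge A eg fh))
        (cong ((l₁ , l₂ , l₃) ⊙_) (sym (Q₁-coefficients-wedges A)))
  where
  identity : ∀ l₁ l₂ l₃ W₁ W₂ W₃ W₄ →
    l₁ * W₁ + (l₂ * W₂ + (- l₂ * W₃ + (l₃ * W₄ + + 0))) ≡ l₁ * W₁ + l₂ * (W₂ - W₃) + l₃ * W₄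
  identity = solve-∀

module _ (D m n : ℤ) where

  corresponds⇒coefficients : ∀ x y A → Corresponds D m n x y A →
    ∃[ s ] ∃[ t ] Q₁-coefficients A ≡ (m , x , s) × Q₂-coefficients A ≡ (n , y , t)
  corresponds⇒coefficients x y A (_ , _ , (s , Q₁≡) , (t , Q₂≡)) =
    s , t ,
    form-injective (Q₁-coefficients A) (m , x , s) (λ u v → trans (sym (Q₁-form A u v)) (Q₁≡ u v)) ,
    form-injective (Q₂-coefficients A) (n , y , t) (λ u v → trans (sym (Q₂-form A u v)) (Q₂≡ u v))

  coefficients⇒corresponds : ∀ {x y s t} A → m ≢ + 0 → n ≢ + 0 → D ≢ + 0 →
    discriminant (m , x , s) ≡ D → Q₁-coefficients A ≡ (m , x , s) → Q₂-coefficients A ≡ (n , y , t) →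
    Corresponds D m n x y A
  coefficients⇒corresponds {s = s} {t} A@(cube _ _ _ _ _ _ _ _) m≢0 n≢0 D≢0 disc≡D Q₁≡ Q₂≡ =
    (m≢0 ∘ trans (sym (cong proj₁ Q₁≡)) , n≢0 ∘ trans (sym (cong proj₁ Q₂≡)) ,
     D≢0 ∘ trans (sym disc-A≡D)) ,
    disc-A≡D ,
    (s , λ u v → trans (Q₁-form A u v) (cong (λ p → form p u v) Q₁≡)) ,
    (t , λ u v → trans (Q₂-form A u v) (cong (λ p → form p u v) Q₂≡))
    where
    disc-A≡D : disc A ≡ D
    disc-A≡D = trans (disc≡discriminant-Q₁ A) (trans (cong discriminant Q₁≡) disc≡D)

  orbit-determines-solution : ∀ x y x′ y′ A A′ → Solution D m n x y → Solution D m n x′ y′ →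
    Corresponds D m n x y A → Corresponds D m n x′ y′ A′ → SameOrbit A A′ → (x , y) ≡ (x′ , y′)
  orbit-determines-solution x y x′ y′ A A′
    (_ , 0≤x , x≤ , _ , 0≤y , y≤) (_ , 0≤x′ , x′≤ , _ , 0≤y′ , y′≤) cA cA′ orbit =
    let s , t , Q₁≡ , Q₂≡ = corresponds⇒coefficients x y A cA
        s′ , t′ , Q₁≡′ , Q₂≡′ = corresponds⇒coefficients x′ y′ A′ cA′
        r₁ , r₂ , sheared₁ , sheared₂ = orbit-shears A A′ orbit
    in cong₂ _,_
      (residue-unique m r₁ 0≤x x≤ 0≤x′ x′≤ (middle (trans (sym Q₁≡′) (trans sheared₁ (cong (shear r₁) Q₁≡)))))
      (residue-unique n r₂ 0≤y y≤ 0≤y′ y′≤ (middle (trans (sym Q₂≡′) (trans sheared₂ (cong (shear r₂) Q₂≡)))))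
    where
    middle : ∀ {p q : Form} → p ≡ q → proj₁ (proj₂ p) ≡ proj₁ (proj₂ q)
    middle = cong (proj₁ ∘ proj₂)

  corresponding-coefficients-equal : ∀ x y A A′ → m ≢ + 0 → n ≢ + 0 →
    Corresponds D m n x y A → Corresponds D m n x y A′ →
    Q₁-coefficients A ≡ Q₁-coefficients A′ × Q₂-coefficients A ≡ Q₂-coefficients A′
  corresponding-coefficients-equal x y A A′ m≢0 n≢0 cA cA′ =
    let s , t , Q₁≡ , Q₂≡ = corresponds⇒coefficients x y A cA
        s′ , t′ , Q₁≡′ , Q₂≡′ = corresponds⇒coefficients x y A′ cA′
        s≡s′ = discriminant-cancel x s s′ m≢0 (trans (via-Q₁ A cA Q₁≡) (sym (via-Q₁ A′ cA′ Q₁≡′)))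
        t≡t′ = discriminant-cancel y t t′ n≢0 (trans (via-Q₂ A cA Q₂≡) (sym (via-Q₂ A′ cA′ Q₂≡′)))
    in trans Q₁≡ (trans (cong (λ z → m , x , z) s≡s′) (sym Q₁≡′)) ,
       trans Q₂≡ (trans (cong (λ z → n , y , z) t≡t′) (sym Q₂≡′))
    where
    via-Q₁ : ∀ B {p} → Corresponds D m n x y B → Q₁-coefficients B ≡ p → discriminant p ≡ D
    via-Q₁ B cB Q₁≡ =
      trans (cong discriminant (sym Q₁≡)) (trans (sym (disc≡discriminant-Q₁ B)) (proj₁ (proj₂ cB)))
    via-Q₂ : ∀ B {p} → Corresponds D m n x y B → Q₂-coefficients B ≡ p → discriminant p ≡ D
    via-Q₂ B cB Q₂≡ =
      trans (cong discriminant (sym Q₂≡)) (trans (sym (disc≡discriminant-Q₂ B)) (proj₁ (proj₂ cB)))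

  corresponding-cubes-same-orbit : ∀ x y A A′ → SquareFree D → m ≢ + 0 → n ≢ + 0 →
    Corresponds D m n x y A → Corresponds D m n x y A′ → SameOrbit A A′
  corresponding-cubes-same-orbit x y A A′ squareFree m≢0 n≢0 cA cA′ =
    let l , Q₁-primitive = squareFree⇒primitive (Q₁-coefficients A) (subst SquareFree D≡disc squareFree)
        G , det≡1 , maps = equal-wedges⇒SL₂-related (column A) (column A′) same-wedges
                             (Q₁-combination l) (trans (weightedWedge-Q₁-combination A l) Q₁-primitive)
    in sameOrbit-act₃ G A A′ det≡1 (act₃-by-columns G A A′ maps)
    where
    D≡disc : D ≡ discriminant (Q₁-coefficients A)
    D≡disc = trans (sym (proj₁ (proj₂ cA))) (disc≡discriminant-Q₁ A)
    same-wedges : ∀ i j → wedge A i j ≡ wedge A′ i j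
    same-wedges = let same₁ , same₂ = corresponding-coefficients-equal x y A A′ m≢0 n≢0 cA cA′
                  in coefficients-determine-wedges A A′ same₁ same₂

  roots-difference : ∀ x y s t → x * x - D ≡ s * (+ 4 * m) → y * y - D ≡ t * (+ 4 * n) →
    x * x - y * y ≡ (m * s - n * t) * + 4
  roots-difference x y s t hs ht = begin
    x * x - y * y                  ≡⟨ insert-D x y D ⟩
    (x * x - D) - (y * y - D)      ≡⟨ cong₂ _-_ hs ht ⟩
    s * (+ 4 * m) - t * (+ 4 * n)  ≡⟨ regroup s t m n ⟩
    (m * s - n * t) * + 4          ∎
    where
    insert-D : ∀ x y D → x * x - y * y ≡ (x * x - D) - (y * y - D)
    insert-D = solve-∀
    regroup : ∀ s t m n → s * (+ 4 * m) - t * (+ 4 * n) ≡ (m * s - n * t) * + 4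
    regroup = solve-∀

  cube-from-roots : ∀ x y s t → D ≢ + 0 → m ≢ + 0 → n ≢ + 0 →
    x * x - D ≡ s * (+ 4 * m) → y * y - D ≡ t * (+ 4 * n) → Σ Cube (Corresponds D m n x y)
  cube-from-roots x y s t D≢0 m≢0 n≢0 hs ht
    with same-parity x y (divides (m * s - n * t) (roots-difference x y s t hs ht))
  ... | k , l , refl , refl =
    explicitCube F l s t ,
    coefficients⇒corresponds (explicitCube F l s t) m≢0 n≢0 D≢0 discriminant≡D
      (proj₁ coefficients) (proj₂ coefficients)
    where
    F : PrimitiveFactorisation m n k
    F = primitiveFactorisation m n k m≢0
    square-difference : ∀ k l → (k + l) * (k + l) - (k - l) * (k - l) ≡ (k * l) * + 4
    square-difference = solve-∀
    relation : m * s - n * t ≡ k * l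
    relation = ℤ.*-cancelʳ-≡ _ _ (+ 4) (trans (sym (roots-difference x y s t hs ht)) (square-difference k l))
    coefficients : Q₁-coefficients (explicitCube F l s t) ≡ (m , k + l , s) ×
                   Q₂-coefficients (explicitCube F l s t) ≡ (n , k - l , t)
    coefficients = explicitCube-coefficients F l s t relation
    rearrange : ∀ X D m s → X - + 4 * m * s ≡ (X - D) - s * (+ 4 * m) + D
    rearrange = solve-∀
    cancel : ∀ z D → z - z + D ≡ D
    cancel = solve-∀
    discriminant≡D : discriminant (m , k + l , s) ≡ D
    discriminant≡D = begin
      (k + l) * (k + l) - + 4 * m * s              ≡⟨ rearrange ((k + l) * (k + l)) D m s ⟩
      ((k + l) * (k + l) - D) - s * (+ 4 * m) + D  ≡⟨ cong (λ z → z - s * (+ 4 * m) + D) hs ⟩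
      s * (+ 4 * m) - s * (+ 4 * m) + D            ≡⟨ cancel (s * (+ 4 * m)) D ⟩
      D                                            ∎

  solution⇒cube : ∀ x y → D ≢ + 0 → m ≢ + 0 → n ≢ + 0 → Solution D m n x y →
    Σ Cube (Corresponds D m n x y)
  solution⇒cube x y D≢0 m≢0 n≢0 (4m∣x²-D , _ , _ , 4n∣y²-D , _ , _) =
    let divides s hs = ∣ᵤ⇒∣ {+ 4 * m} 4m∣x²-D
        divides t ht = ∣ᵤ⇒∣ {+ 4 * n} 4n∣y²-D
    in cube-from-roots x y s t D≢0 m≢0 n≢0 hs ht

proposition3p4 : (D m n : ℤ) → D ≢ + 0 → SquareFree D → m ≢ + 0 → n ≢ + 0 →
    ((x y : ℤ) → Solution D m n x y →
      Σ Cube (λ A → Corresponds D m n x y A) ×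
      ((A A' : Cube) → Corresponds D m n x y A → Corresponds D m n x y A' → SameOrbit A A'))
    ×
    ((x y x' y' : ℤ) (A A' : Cube) → Solution D m n x y → Solution D m n x' y' →
      Corresponds D m n x y A → Corresponds D m n x' y' A' →
      (x , y) ≢ (x' , y') → ¬ SameOrbit A A')
proposition3p4 D m n D≢0 squareFree m≢0 n≢0 =
  (λ x y solution →
     solution⇒cube D m n x y D≢0 m≢0 n≢0 solution ,
     λ A A′ → corresponding-cubes-same-orbit D m n x y A A′ squareFree m≢0 n≢0) ,
  λ x y x′ y′ A A′ solution solution′ cA cA′ different orbit →
    different (orbit-determines-solution D m n x y x′ y′ A A′ solution solution′ cA cA′ orbit)
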